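{- Let $p,q$ be positive integers with $p\ge q$. A signed graph $\hat G=(G,\sigma)$ admits a $(2p,q)$-flow if and only if the graph $(2p-2q)G$ admits a $(\mathbb{Z}_{4p},\beta)$-orientation, where $\beta(v)\equiv 2p\cdot d^+(v)\pmod{4p}$ for every vertex $v\in V(G)$ and $d^+(v)$ is the number of positive edges of $\hat G$ incident to $v$.
   Context: Graphs are finite, may have multiple edges but no loops; $mG$ denotes the graph obtained from $G$ by replacing each edge with $m$ parallel edges. For an orientation $D$ and $f:E(G)\to\mathbb{Z}$, $\partial_Df(v)$ is the sum of $f$ over out-arcs at $v$ minus the sum over in-arcs. For an even integer $P$ and an integer $Q\le P/2$, a $(P,Q)$-flow in a signed graph is a pair $(D,f)$ with $D$ an orientation and $f:E(G)\to\mathbb{Z}$ such that $f(e)\in\{Q,\dots,P-Q\}$ for each positive edge, $f(e)\in\{0,\dots,\frac P2-Q\}\cup\{\frac P2+Q,\dots,P-1\}$ for each negative edge, and $\partial_Df(v)=0$ for every vertex. For a graph $H$ and a map $\beta:V(H)\to\mathbb{Z}$, a $(\mathbb{Z}_{m},\beta)$-orientation of $H$ is an orientation $D$ of $H$ such that for every vertex $v$, (out-degree of $v$) $-$ (in-degree of $v$) $\equiv\beta(v)\pmod m$. -}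

module Defs where

open import Data.Nat as ℕ using (ℕ; zero; suc)
open import Data.Nat.DivMod using (_/_)
open import Data.Integer as ℤ using (ℤ; +_; _+_; _-_; _*_; _≤_)
open import Data.Integer.Divisibility using (_∣_)
open import Data.Fin as Fin using (Fin; remainder)
open import Data.Fin.Properties using (_≟_)
open import Data.Product using (_×_; _,_; proj₁; proj₂; Σ)
open import Data.Sum using (_⊎_)
open import Data.Bool using (Bool; true; false; if_then_else_)
open import Relation.Nullary using (¬_; Dec; yes; no)
open import Relation.Binary.PropositionalEquality using (_≡_)

record Graph : Set where
  field
    nV    : ℕ
    nE    : ℕ
    ends  : Fin nE → Fin nV × Fin nV
    noLoop : ∀ e → ¬ (proj₁ (ends e) ≡ proj₂ (ends e))
open Graph public

-- k G : every edge replaced by k parallel copies; edge set Fin (k * nE)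
mult : ℕ → Graph → Graph
mult k G = record
  { nV = nV G
  ; nE = k ℕ.* nE G
  ; ends = λ e → ends G (remainder {k} (nE G) e)
  ; noLoop = λ e → noLoop G (remainder {k} (nE G) e)
  }

sumFin : (m : ℕ) → (Fin m → ℤ) → ℤ
sumFin zero    f = + 0
sumFin (suc m) f = f Fin.zero + sumFin m (λ i → f (Fin.suc i))

-- Orientation of G: for each edge, true = oriented from proj₁ (ends e) to
-- proj₂ (ends e), false = the reverse.
Orientation : Graph → Set
Orientation G = Fin (nE G) → Bool

tail head : (G : Graph) → Orientation G → Fin (nE G) → Fin (nV G)
tail G D e = if D e then proj₁ (ends G e) else proj₂ (ends G e)
head G D e = if D e then proj₂ (ends G e) else proj₁ (ends G e)

ifEq : ∀ {n} → Fin n → Fin n → ℤ → ℤ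
ifEq u v x with u ≟ v
... | yes _ = x
... | no  _ = + 0

∂ : (G : Graph) → Orientation G → (Fin (nE G) → ℤ) → Fin (nV G) → ℤ
∂ G D f v = sumFin (nE G) (λ e → ifEq (tail G D e) v (f e))
          - sumFin (nE G) (λ e → ifEq (head G D e) v (f e))

outMinusIn : (G : Graph) → Orientation G → Fin (nV G) → ℤ
outMinusIn G D = ∂ G D (λ _ → + 1)

data Sign : Set where
  pos neg : Sign

Signature : Graph → Set
Signature G = Fin (nE G) → Sign

posIndicator : Sign → ℤ
posIndicator pos = + 1
posIndicator neg = + 0

dplus : (G : Graph) → Signature G → Fin (nV G) → ℤ
dplus G σ v = sumFin (nE G) (λ e →
  ifEq (proj₁ (ends G e)) v (posIndicator (σ e))
  + ifEq (proj₂ (ends G e)) v (posIndicator (σ e)))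

_≡_[mod_] : ℤ → ℤ → ℕ → Set
a ≡ b [mod m ] = (+ m) ∣ (a - b)

FlowValue : (P Q : ℕ) → Sign → ℤ → Set
FlowValue P Q pos x = (+ Q ≤ x) × (x ≤ + (P ℕ.∸ Q))
FlowValue P Q neg x =
    ((+ 0 ≤ x) × (x ≤ + ((P / 2) ℕ.∸ Q)))
  ⊎ ((+ ((P / 2) ℕ.+ Q) ≤ x) × (x ≤ + (P ℕ.∸ 1)))

record PQFlow (P Q : ℕ) (G : Graph) (σ : Signature G) : Set where
  field
    D       : Orientation G
    f       : Fin (nE G) → ℤ
    values  : ∀ e → FlowValue P Q (σ e) (f e)
    conserv : ∀ v → ∂ G D f v ≡ + 0

record ZmOrientation (m : ℕ) (H : Graph) (β : Fin (nV H) → ℤ) : Set where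
  field
    D     : Orientation H
    bound : ∀ v → outMinusIn H D v ≡ β v [mod m ]

-- A flow value f on an edge, negated when the edge is traversed against a fixed reference
-- orientation, is determined modulo 2p by its residue g = ±f − p·[edge positive] reduced into
-- [−(p−q), p−q]; conversely every such residue lifts to an admissible (2p,q)-flow value in
-- [0, 2p). Orienting t = g + (p−q) of the 2(p−q) copies of the edge forwards contributes 2g to
-- out-degree minus in-degree, so the orientation of (2p−2q)G is a (ℤ₄ₚ, 2p·d⁺)-orientation exactly
-- when 2·∂g ≡ 2p·d⁺ (mod 4p). Given a flow this holds because ∂f = 0. Given the orientation, the
-- lifted values r satisfy ∂r = 2p·d for an integer demand d; then r/2p is a fractional 0/1 flow
-- with boundary d, and by Hoffman's circulation theorem (proved here constructively, by induction
-- on the edges and uncrossing of tight sets) there is an integral 0/1 flow x with boundary d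
-- supported where r ≠ 0. Reversing the edges with x = 1 and replacing r by 2p − r on them gives
-- a (2p,q)-flow.

module Submission where

open import Defs

open import Data.Bool using (Bool; true; false; if_then_else_; _∧_; _∨_; not; T)
open import Data.Empty using (⊥-elim)
open import Data.Fin as Fin using (Fin; zero; suc; _↑ˡ_; _↑ʳ_; combine; remainder; quotient; toℕ)
import Data.Fin.Properties as Finₚ
open import Data.Fin.Subset.Properties using (anySubset?)
open import Data.Integer as ℤ using (ℤ; +_; -_; +≤+; _+_; _-_; _*_; _≤_; _<_)
import Data.Integer.Divisibility.Signed as Signed
import Data.Integer.Properties as ℤₚ
open import Data.Integer.Tactic.RingSolver using (solve; solve-∀)
open import Data.List using (_∷_; [])
open import Data.Nat as ℕ using (ℕ; zero; suc; z≤n; s≤s)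
open import Data.Nat.DivMod using (_/_; m*n/n≡m)
import Data.Nat.Properties as ℕₚ
open import Data.Product using (_×_; _,_; proj₁; proj₂; ∃-syntax)
open import Data.Sum using (_⊎_; inj₁; inj₂)
import Data.Vec as Vec
import Data.Vec.Properties as Vecₚ
open import Function using (_∘_; id; _⇔_; mk⇔)
open import Relation.Binary.PropositionalEquality hiding ([_])
open import Relation.Nullary using (¬_; Dec; yes; no; does; ¬?)
open import Relation.Nullary.Decidable using (True; toWitness; decidable-stable)

open import Algebra.Properties.Ring ℤₚ.+-*-ring using (x[y-z]≈xy-xz; [y-z]x≈yx-zx)
open import Algebra.Properties.Semiring.Sum ℤₚ.+-*-semiring
  using ( sum; sum-syntax; sum-remove; sum-cong-≗; sum-replicate-zero
        ; ∑-distrib-+; ∑-comm; *-distribˡ-sum; *-distribʳ-sum )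

private variable
  n m k : ℕ

sumFin≡sum : ∀ m (f : Fin m → ℤ) → sumFin m f ≡ sum f
sumFin≡sum zero    f = refl
sumFin≡sum (suc m) f = cong (_+_ (f zero)) (sumFin≡sum m (f ∘ suc))

∑-neg : (g : Fin n → ℤ) → ∑[ i < n ] (- g i) ≡ - sum g
∑-neg {zero}  g = refl
∑-neg {suc n} g = trans (cong (_+_ (- g zero)) (∑-neg (g ∘ suc)))
                        (sym (ℤₚ.neg-distrib-+ (g zero) (sum (g ∘ suc))))

∑-distrib-- : (f g : Fin n → ℤ) → ∑[ i < n ] (f i - g i) ≡ sum f - sum g
∑-distrib-- f g = trans (∑-distrib-+ f (-_ ∘ g)) (cong (_+_ (sum f)) (∑-neg g))

∑-mono-≤ : {f g : Fin n → ℤ} → (∀ i → f i ≤ g i) → sum f ≤ sum g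
∑-mono-≤ {zero}  f≤g = ℤₚ.≤-refl
∑-mono-≤ {suc n} f≤g = ℤₚ.+-mono-≤ (f≤g zero) (∑-mono-≤ (f≤g ∘ suc))

∑-one : ∀ n → ∑[ i < n ] (+ 1) ≡ + n
∑-one zero    = refl
∑-one (suc n) = cong (_+_ (+ 1)) (∑-one n)

∑-++ : ∀ m (f : Fin (m ℕ.+ k) → ℤ) →
       sum f ≡ ∑[ i < m ] f (i ↑ˡ k) + ∑[ j < k ] f (m ↑ʳ j)
∑-++ zero    f = sym (ℤₚ.+-identityˡ (sum f))
∑-++ (suc m) f = trans (cong (_+_ (f zero)) (∑-++ m (f ∘ suc)))
                       (sym (ℤₚ.+-assoc (f zero) _ _))

∑-combine : ∀ k (f : Fin (k ℕ.* m) → ℤ) → sum f ≡ ∑[ i < k ] ∑[ j < m ] f (combine i j)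
∑-combine zero    f = refl
∑-combine {m} (suc k) f =
  trans (∑-++ m f) (cong (_+_ (∑[ j < m ] f (j ↑ˡ (k ℕ.* m)))) (∑-combine k (f ∘ (m ↑ʳ_))))

+-cancelˡ-≤ : ∀ i {j k} → i + j ≤ i + k → j ≤ k
+-cancelˡ-≤ i {j} {k} i+j≤i+k = subst₂ _≤_ (cancel j) (cancel k) (ℤₚ.+-monoʳ-≤ (- i) i+j≤i+k)
  where
  cancel : ∀ x → - i + (i + x) ≡ x
  cancel x = solve (i ∷ x ∷ [])

i≤k+j⇒i-k≤j : ∀ {i} k {j} → i ≤ k + j → i - k ≤ j
i≤k+j⇒i-k≤j {i} k {j} i≤k+j = subst (i - k ≤_) (cancel j) (ℤₚ.+-monoˡ-≤ (- k) i≤k+j)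
  where
  cancel : ∀ x → k + x - k ≡ x
  cancel x = solve (k ∷ x ∷ [])

i≤i+j : ∀ i {j} → + 0 ≤ j → i ≤ i + j
i≤i+j i {j} 0≤j = subst (_≤ i + j) (ℤₚ.+-identityʳ i) (ℤₚ.+-monoʳ-≤ i 0≤j)

i-j≤i : ∀ i {j} → + 0 ≤ j → i - j ≤ i
i-j≤i i {j} 0≤j = subst (i - j ≤_) (ℤₚ.+-identityʳ i) (ℤₚ.+-monoʳ-≤ i (ℤₚ.neg-mono-≤ 0≤j))

0≤i⇒i≢0⇒1≤i : ∀ {r} → + 0 ≤ r → r ≢ + 0 → + 1 ≤ r
0≤i⇒i≢0⇒1≤i {+ zero}  _ r≢0 = ⊥-elim (r≢0 refl)
0≤i⇒i≢0⇒1≤i {+ suc _} _ _   = +≤+ (s≤s z≤n)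

i<0⇒i≤-1 : ∀ {g} → g < + 0 → g ≤ - + 1
i<0⇒i≤-1 g<0 = +-cancelˡ-≤ (+ 1) (ℤₚ.i<j⇒suc[i]≤j g<0)

pos-∸ : ∀ {m n} → n ℕ.≤ m → + (m ℕ.∸ n) ≡ + m - + n
pos-∸ {m} {n} n≤m = trans (sym (ℤₚ.⊖-≥ n≤m)) (sym (ℤₚ.m-n≡m⊖n m n))

infix 4 _∈[_,_]
_∈[_,_] : ℤ → ℤ → ℤ → Set
x ∈[ lo , hi ] = lo ≤ x × x ≤ hi

∈-shift : ∀ {x lo hi} c → x ∈[ lo , hi ] → x + c ∈[ lo + c , hi + c ]
∈-shift c (lo≤x , x≤hi) = ℤₚ.+-monoˡ-≤ c lo≤x , ℤₚ.+-monoˡ-≤ c x≤hi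

∈-reflect : ∀ {x lo hi} c → x ∈[ lo , hi ] → c - x ∈[ c - hi , c - lo ]
∈-reflect c (lo≤x , x≤hi) =
  ℤₚ.+-monoʳ-≤ c (ℤₚ.neg-mono-≤ x≤hi) , ℤₚ.+-monoʳ-≤ c (ℤₚ.neg-mono-≤ lo≤x)

∈-negate : ∀ {x lo hi} → x ∈[ lo , hi ] → - x ∈[ - hi , - lo ]
∈-negate (lo≤x , x≤hi) = ℤₚ.neg-mono-≤ x≤hi , ℤₚ.neg-mono-≤ lo≤x

∈-cast : ∀ {x lo hi} → x ∈[ lo , hi ] → ∀ lo′ hi′ → lo ≡ lo′ → hi ≡ hi′ → x ∈[ lo′ , hi′ ]
∈-cast x∈ _ _ refl refl = x∈

∈-weaken : ∀ {x lo hi lo′ hi′} → lo′ ≤ lo → hi ≤ hi′ → x ∈[ lo , hi ] → x ∈[ lo′ , hi′ ]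
∈-weaken lo′≤lo hi≤hi′ (lo≤x , x≤hi) = ℤₚ.≤-trans lo′≤lo lo≤x , ℤₚ.≤-trans x≤hi hi≤hi′

ifEq-refl : (a : Fin n) (x : ℤ) → ifEq a a x ≡ x
ifEq-refl a x with a Finₚ.≟ a
... | yes _   = refl
... | no  a≢a = ⊥-elim (a≢a refl)

ifEq-≢ : {a b : Fin n} (x : ℤ) → a ≢ b → ifEq a b x ≡ + 0
ifEq-≢ {a = a} {b} x a≢b with a Finₚ.≟ b
... | yes a≡b = ⊥-elim (a≢b a≡b)
... | no  _   = refl

ifEq-scale : (a b : Fin n) (x : ℤ) → ifEq a b x ≡ ifEq a b (+ 1) * x
ifEq-scale a b x with a Finₚ.≟ b
... | yes _ = sym (ℤₚ.*-identityˡ x)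
... | no  _ = refl

∑-ifEq : (a : Fin n) (g : Fin n → ℤ) → ∑[ v < n ] ifEq a v (g v) ≡ g a
∑-ifEq {suc n} a g = begin
  ∑[ v < suc n ] ifEq a v (g v)
    ≡⟨ sum-remove {i = a} (λ v → ifEq a v (g v)) ⟩
  ifEq a a (g a) + ∑[ j < n ] ifEq a (Fin.punchIn a j) _
    ≡⟨ cong₂ _+_ (ifEq-refl a (g a)) (trans (sum-cong-≗ off-a) (sum-replicate-zero n)) ⟩
  g a + + 0                                       ≡⟨ ℤₚ.+-identityʳ (g a) ⟩
  g a                                             ∎
  where
  open ≡-Reasoning
  off-a : ∀ j → ifEq a (Fin.punchIn a j) (g (Fin.punchIn a j)) ≡ + 0
  off-a j = ifEq-≢ _ (Finₚ.punchInᵢ≢i a j ∘ sym)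

Ends : ℕ → ℕ → Set
Ends n m = Fin m → Fin n × Fin n

incidence : Fin n × Fin n → Fin n → ℤ
incidence uv v = ifEq (proj₁ uv) v (+ 1) - ifEq (proj₂ uv) v (+ 1)

boundary : Ends n m → (Fin m → ℤ) → Fin n → ℤ
boundary {m = m} en F v = ∑[ e < m ] (incidence (en e) v * F e)

module _ (en : Ends n m) where

  boundary-cong : {F H : Fin m → ℤ} → (∀ e → F e ≡ H e) →
                  ∀ v → boundary en F v ≡ boundary en H v
  boundary-cong F≗H v = sum-cong-≗ (λ e → cong (incidence (en e) v *_) (F≗H e))

  boundary-+ : (F H : Fin m → ℤ) (v : Fin n) →
               boundary en (λ e → F e + H e) v ≡ boundary en F v + boundary en H v
  boundary-+ F H v =
    trans (sum-cong-≗ {m} (λ e → ℤₚ.*-distribˡ-+ (incidence (en e) v) (F e) (H e)))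
          (∑-distrib-+ {m} _ _)

  boundary-* : (c : ℤ) (F : Fin m → ℤ) (v : Fin n) →
               boundary en (λ e → c * F e) v ≡ c * boundary en F v
  boundary-* c F v = trans (sum-cong-≗ {m} (λ e → rearrange (incidence (en e) v) (F e)))
                           (sym (*-distribˡ-sum {m} c _))
    where
    rearrange : ∀ a x → a * (c * x) ≡ c * (a * x)
    rearrange a x = solve (a ∷ c ∷ x ∷ [])

  boundary-linear : ∀ α β γ (F G H L : Fin m → ℤ) → (∀ e → L e ≡ α * F e + β * G e + γ * H e) →
    ∀ v → boundary en L v ≡ α * boundary en F v + β * boundary en G v + γ * boundary en H v
  boundary-linear α β γ F G H L L≡ v = begin
    boundary en L v
      ≡⟨ boundary-cong L≡ v ⟩
    boundary en (λ e → α * F e + β * G e + γ * H e) v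
      ≡⟨ boundary-+ (λ e → α * F e + β * G e) (λ e → γ * H e) v ⟩
    boundary en (λ e → α * F e + β * G e) v + boundary en (λ e → γ * H e) v
      ≡⟨ cong₂ _+_ (boundary-+ (λ e → α * F e) (λ e → β * G e) v) (boundary-* γ H v) ⟩
    boundary en (λ e → α * F e) v + boundary en (λ e → β * G e) v + γ * boundary en H v
      ≡⟨ cong₂ (λ x y → x + y + γ * boundary en H v) (boundary-* α F v) (boundary-* β G v) ⟩
    α * boundary en F v + β * boundary en G v + γ * boundary en H v  ∎
    where open ≡-Reasoning

[_] : Bool → ℤ
[ b ] = if b then + 1 else + 0

_⟨_⟩ : (Fin n → ℤ) → (Fin n → Bool) → ℤ
_⟨_⟩ {n} d S = ∑[ v < n ] ([ S v ] * d v)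

⟨⟩-all : (d : Fin n → ℤ) → d ⟨ (λ _ → true) ⟩ ≡ sum d
⟨⟩-all d = sum-cong-≗ (λ v → ℤₚ.*-identityˡ (d v))

⟨⟩-congˡ : {d d′ : Fin n → ℤ} (S : Fin n → Bool) → (∀ v → d v ≡ d′ v) → d ⟨ S ⟩ ≡ d′ ⟨ S ⟩
⟨⟩-congˡ S d≗d′ = sum-cong-≗ (λ v → cong ([ S v ] *_) (d≗d′ v))

⟨⟩-congʳ : (d : Fin n → ℤ) {S T : Fin n → Bool} → (∀ v → S v ≡ T v) → d ⟨ S ⟩ ≡ d ⟨ T ⟩
⟨⟩-congʳ d S≗T = sum-cong-≗ (λ v → cong (λ b → [ b ] * d v) (S≗T v))

⟨⟩-* : (c : ℤ) (d : Fin n → ℤ) (S : Fin n → Bool) → c * d ⟨ S ⟩ ≡ (λ v → c * d v) ⟨ S ⟩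
⟨⟩-* {n} c d S =
  trans (*-distribˡ-sum c (λ v → [ S v ] * d v)) (sum-cong-≗ (λ v → swap [ S v ] (d v)))
  where
  swap : ∀ b x → c * (b * x) ≡ b * (c * x)
  swap b x = solve (c ∷ b ∷ x ∷ [])

∑-incidence : (S : Fin n → Bool) (uv : Fin n × Fin n) →
              ∑[ v < n ] ([ S v ] * incidence uv v) ≡ [ S (proj₁ uv) ] - [ S (proj₂ uv) ]
∑-incidence {n} S (u , w) = begin
  ∑[ v < n ] ([ S v ] * (ifEq u v (+ 1) - ifEq w v (+ 1)))
    ≡⟨ sum-cong-≗ (λ v → x[y-z]≈xy-xz [ S v ] (ifEq u v (+ 1)) (ifEq w v (+ 1))) ⟩
  ∑[ v < n ] ([ S v ] * ifEq u v (+ 1) - [ S v ] * ifEq w v (+ 1))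
    ≡⟨ ∑-distrib-- (λ v → [ S v ] * ifEq u v (+ 1)) (λ v → [ S v ] * ifEq w v (+ 1)) ⟩
  ∑[ v < n ] ([ S v ] * ifEq u v (+ 1)) - ∑[ v < n ] ([ S v ] * ifEq w v (+ 1))
    ≡⟨ cong₂ _-_ (pick u) (pick w) ⟩
  [ S u ] - [ S w ]  ∎
  where
  open ≡-Reasoning
  pick : ∀ a → ∑[ v < n ] ([ S v ] * ifEq a v (+ 1)) ≡ [ S a ]
  pick a = trans (sum-cong-≗ (λ v → trans (ℤₚ.*-comm [ S v ] _) (sym (ifEq-scale a v [ S v ]))))
                 (∑-ifEq a (λ v → [ S v ]))

⟨⟩-shift : (d : Fin n → ℤ) (uv : Fin n × Fin n) (S : Fin n → Bool) →
           (λ v → d v - incidence uv v) ⟨ S ⟩ ≡ d ⟨ S ⟩ - ([ S (proj₁ uv) ] - [ S (proj₂ uv) ])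
⟨⟩-shift {n} d uv S = begin
  ∑[ v < n ] ([ S v ] * (d v - incidence uv v))
    ≡⟨ sum-cong-≗ (λ v → x[y-z]≈xy-xz [ S v ] (d v) (incidence uv v)) ⟩
  ∑[ v < n ] ([ S v ] * d v - [ S v ] * incidence uv v)
    ≡⟨ ∑-distrib-- (λ v → [ S v ] * d v) (λ v → [ S v ] * incidence uv v) ⟩
  d ⟨ S ⟩ - ∑[ v < n ] ([ S v ] * incidence uv v)
    ≡⟨ cong (d ⟨ S ⟩ -_) (∑-incidence S uv) ⟩
  d ⟨ S ⟩ - ([ S (proj₁ uv) ] - [ S (proj₂ uv) ])  ∎
  where open ≡-Reasoning

module _ (en : Ends n m) where

  boundary⟨⟩ : (F : Fin m → ℤ) (S : Fin n → Bool) →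
               boundary en F ⟨ S ⟩ ≡ ∑[ e < m ] (([ S (proj₁ (en e)) ] - [ S (proj₂ (en e)) ]) * F e)
  boundary⟨⟩ F S = begin
    ∑[ v < n ] ([ S v ] * ∑[ e < m ] (incidence (en e) v * F e))
      ≡⟨ sum-cong-≗ (λ v → *-distribˡ-sum [ S v ] (λ e → incidence (en e) v * F e)) ⟩
    ∑[ v < n ] ∑[ e < m ] ([ S v ] * (incidence (en e) v * F e))
      ≡⟨ ∑-comm (λ v e → [ S v ] * (incidence (en e) v * F e)) ⟩
    ∑[ e < m ] ∑[ v < n ] ([ S v ] * (incidence (en e) v * F e))
      ≡⟨ sum-cong-≗ (λ e → trans (sum-cong-≗ (λ v → sym (ℤₚ.*-assoc [ S v ] (incidence (en e) v) (F e))))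
                                 (sym (*-distribʳ-sum (F e) (λ v → [ S v ] * incidence (en e) v)))) ⟩
    ∑[ e < m ] (∑[ v < n ] ([ S v ] * incidence (en e) v) * F e)
      ≡⟨ sum-cong-≗ (λ e → cong (_* F e) (∑-incidence S (en e))) ⟩
    ∑[ e < m ] (([ S (proj₁ (en e)) ] - [ S (proj₂ (en e)) ]) * F e)  ∎
    where open ≡-Reasoning

  ∑-boundary : (F : Fin m → ℤ) → sum (boundary en F) ≡ + 0
  ∑-boundary F = begin
    sum (boundary en F)                    ≡⟨ ⟨⟩-all (boundary en F) ⟨
    boundary en F ⟨ (λ _ → true) ⟩         ≡⟨ boundary⟨⟩ F (λ _ → true) ⟩
    ∑[ e < m ] (+ 0 * F e)                 ≡⟨ sum-cong-≗ {m} (λ e → ℤₚ.*-zeroˡ (F e)) ⟩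
    ∑[ e < m ] (+ 0)                       ≡⟨ sum-replicate-zero m ⟩
    + 0                                    ∎
    where open ≡-Reasoning

_∪_ _∩_ : (Fin n → Bool) → (Fin n → Bool) → Fin n → Bool
(S ∪ T) v = S v ∨ T v
(S ∩ T) v = S v ∧ T v

⟨⟩-modular : (d : Fin n → ℤ) (S T : Fin n → Bool) →
             d ⟨ S ∪ T ⟩ + d ⟨ S ∩ T ⟩ ≡ d ⟨ S ⟩ + d ⟨ T ⟩
⟨⟩-modular {n} d S T = begin
  d ⟨ S ∪ T ⟩ + d ⟨ S ∩ T ⟩
    ≡⟨ ∑-distrib-+ (λ v → [ S v ∨ T v ] * d v) (λ v → [ S v ∧ T v ] * d v) ⟨
  ∑[ v < n ] ([ S v ∨ T v ] * d v + [ S v ∧ T v ] * d v)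
    ≡⟨ sum-cong-≗ (λ v → per-vertex (S v) (T v) (d v)) ⟩
  ∑[ v < n ] ([ S v ] * d v + [ T v ] * d v)
    ≡⟨ ∑-distrib-+ (λ v → [ S v ] * d v) (λ v → [ T v ] * d v) ⟩
  d ⟨ S ⟩ + d ⟨ T ⟩  ∎
  where
  open ≡-Reasoning
  per-vertex : ∀ x y z → [ x ∨ y ] * z + [ x ∧ y ] * z ≡ [ x ] * z + [ y ] * z
  per-vertex true  true  z = refl
  per-vertex true  false z = refl
  per-vertex false true  z = ℤₚ.+-comm ([ true ] * z) ([ false ] * z)
  per-vertex false false z = refl

⟨⟩-complement : (d : Fin n → ℤ) (S : Fin n → Bool) → d ⟨ S ⟩ + d ⟨ not ∘ S ⟩ ≡ sum d
⟨⟩-complement {n} d S =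
  trans (sym (∑-distrib-+ (λ v → [ S v ] * d v) (λ v → [ not (S v) ] * d v)))
        (sum-cong-≗ (λ v → per-vertex (S v) (d v)))
  where
  per-vertex : ∀ b z → [ b ] * z + [ not b ] * z ≡ z
  per-vertex true  z = trans (ℤₚ.+-identityʳ (+ 1 * z)) (ℤₚ.*-identityˡ z)
  per-vertex false z = trans (ℤₚ.+-identityˡ (+ 1 * z)) (ℤₚ.*-identityˡ z)

⟨⟩-singleton : (d : Fin n → ℤ) (v : Fin n) → d ⟨ (λ u → does (v Finₚ.≟ u)) ⟩ ≡ d v
⟨⟩-singleton d v = trans (sum-cong-≗ per-vertex) (∑-ifEq v d)
  where
  per-vertex : ∀ u → [ does (v Finₚ.≟ u) ] * d u ≡ ifEq v u (d u)
  per-vertex u with v Finₚ.≟ u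
  ... | yes _ = ℤₚ.*-identityˡ (d u)
  ... | no  _ = refl

-- Hoffman's theorem for 0/1 flows

Submodular : ((Fin n → Bool) → ℤ) → Set
Submodular c = ∀ S T → c (S ∪ T) + c (S ∩ T) ≤ c S + c T

cut : Ends n m → (Fin m → Bool) → (Fin n → Bool) → ℤ
cut {m = m} en act S = ∑[ e < m ] [ act e ∧ S (proj₁ (en e)) ∧ not (S (proj₂ (en e))) ]

cut-cong : (en : Ends n m) (act : Fin m → Bool) {S T : Fin n → Bool} →
           (∀ v → S v ≡ T v) → cut en act S ≡ cut en act T
cut-cong en act S≗T = sum-cong-≗ (λ e → cong₂ (λ x y → [ act e ∧ x ∧ not y ]) (S≗T _) (S≗T _))

private
  by-evaluation : ∀ {i j} {i≤j : True (i ℤₚ.≤? j)} → i ≤ j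
  by-evaluation {i≤j = i≤j} = toWitness i≤j

leaving-submodular : ∀ a x y x′ y′ →
  [ a ∧ (x ∨ y) ∧ not (x′ ∨ y′) ] + [ a ∧ (x ∧ y) ∧ not (x′ ∧ y′) ]
    ≤ [ a ∧ x ∧ not x′ ] + [ a ∧ y ∧ not y′ ]
leaving-submodular false _     _     _     _     = ℤₚ.≤-refl
leaving-submodular true  false false _     _     = ℤₚ.≤-refl
leaving-submodular true  true  false true  true  = by-evaluation
leaving-submodular true  true  false true  false = by-evaluation
leaving-submodular true  true  false false true  = by-evaluation
leaving-submodular true  true  false false false = by-evaluation
leaving-submodular true  false true  true  true  = by-evaluation
leaving-submodular true  false true  true  false = by-evaluation
leaving-submodular true  false true  false true  = by-evaluation
leaving-submodular true  false true  false false = by-evaluation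
leaving-submodular true  true  true  true  true  = by-evaluation
leaving-submodular true  true  true  true  false = by-evaluation
leaving-submodular true  true  true  false true  = by-evaluation
leaving-submodular true  true  true  false false = by-evaluation

cut-submodular : (en : Ends n m) (act : Fin m → Bool) → Submodular (cut en act)
cut-submodular {n} {m} en act S T = begin
  cut en act (S ∪ T) + cut en act (S ∩ T)  ≡⟨ ∑-distrib-+ (leaving (S ∪ T)) (leaving (S ∩ T)) ⟨
  ∑[ e < m ] (leaving (S ∪ T) e + leaving (S ∩ T) e)
    ≤⟨ ∑-mono-≤ (λ e → leaving-submodular (act e) (S (t e)) (T (t e)) (S (h e)) (T (h e))) ⟩
  ∑[ e < m ] (leaving S e + leaving T e)   ≡⟨ ∑-distrib-+ (leaving S) (leaving T) ⟩
  cut en act S + cut en act T              ∎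
  where
  open ℤₚ.≤-Reasoning
  t h : Fin m → Fin n
  t e = proj₁ (en e)
  h e = proj₂ (en e)
  leaving : (Fin n → Bool) → Fin m → ℤ
  leaving S e = [ act e ∧ S (t e) ∧ not (S (h e)) ]

module Uncrossing
  (c : (Fin n → Bool) → ℤ) (c-submodular : Submodular c) (d : Fin n → ℤ) (a b : Fin n)
  (d≤c+ab : ∀ S → d ⟨ S ⟩ ≤ [ S a ∧ not (S b) ] + c S)
  (S₁ : Fin n → Bool) (S₁-violated : ¬ d ⟨ S₁ ⟩ ≤ c S₁) where

  private
    d≤c+ab′ : ∀ S {x y} → S a ≡ x → S b ≡ y → d ⟨ S ⟩ ≤ [ x ∧ not y ] + c S
    d≤c+ab′ S refl refl = d≤c+ab S

    no-bonus : ∀ {S} → d ⟨ S ⟩ ≤ + 0 + c S → d ⟨ S ⟩ ≤ c S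
    no-bonus {S} = subst (d ⟨ S ⟩ ≤_) (ℤₚ.+-identityˡ (c S))

    S₁-separates : S₁ a ≡ true × S₁ b ≡ false
    S₁-separates with S₁ a in S₁a | S₁ b in S₁b
    ... | true  | false = refl , refl
    ... | true  | true  = ⊥-elim (S₁-violated (no-bonus (d≤c+ab′ S₁ S₁a S₁b)))
    ... | false | _     = ⊥-elim (S₁-violated (no-bonus (d≤c+ab′ S₁ S₁a S₁b)))

    crossing-bound : ∀ {dU dI d₁ d₂ cU cI c₁ c₂} → dU ≤ cU → dI ≤ cI →
                     dU + dI ≡ d₁ + d₂ → cU + cI ≤ c₁ + c₂ → c₁ < d₁ → d₂ + + 1 ≤ c₂
    crossing-bound {dU} {dI} {d₁} {d₂} {cU} {cI} {c₁} {c₂} dU≤cU dI≤cI modular submodular c₁<d₁ =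
      +-cancelˡ-≤ c₁ (begin
        c₁ + (d₂ + + 1)  ≡⟨ solve (c₁ ∷ d₂ ∷ []) ⟩
        (+ 1 + c₁) + d₂  ≤⟨ ℤₚ.+-monoˡ-≤ d₂ (ℤₚ.i<j⇒suc[i]≤j c₁<d₁) ⟩
        d₁ + d₂          ≡⟨ modular ⟨
        dU + dI          ≤⟨ ℤₚ.+-mono-≤ dU≤cU dI≤cI ⟩
        cU + cI          ≤⟨ submodular ⟩
        c₁ + c₂          ∎)
      where open ℤₚ.≤-Reasoning

  uncross : ∀ S → d ⟨ S ⟩ - ([ S a ] - [ S b ]) ≤ c S
  uncross S with S a in Sa | S b in Sb
  ... | true  | true  = i≤k+j⇒i-k≤j (+ 0) (d≤c+ab′ S Sa Sb)
  ... | true  | false = i≤k+j⇒i-k≤j (+ 1) (d≤c+ab′ S Sa Sb)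
  ... | false | false = i≤k+j⇒i-k≤j (+ 0) (d≤c+ab′ S Sa Sb)
  ... | false | true  =
    crossing-bound (no-bonus (d≤c+ab′ (S₁ ∪ S) Ua Ub)) (no-bonus (d≤c+ab′ (S₁ ∩ S) Ia Ib))
                   (⟨⟩-modular d S₁ S) (c-submodular S₁ S) (ℤₚ.≰⇒> S₁-violated)
    where
    Ua : S₁ a ∨ S a ≡ true
    Ua = cong₂ _∨_ (proj₁ S₁-separates) Sa
    Ub : S₁ b ∨ S b ≡ true
    Ub = cong₂ _∨_ (proj₂ S₁-separates) Sb
    Ia : S₁ a ∧ S a ≡ false
    Ia = cong₂ _∧_ (proj₁ S₁-separates) Sa
    Ib : S₁ b ∧ S b ≡ false
    Ib = cong₂ _∧_ (proj₂ S₁-separates) Sb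

∀-or-counterexample : (P : (Fin n → Bool) → Set) → (∀ S → Dec (P S)) →
  (∀ {S T} → (∀ v → S v ≡ T v) → P S → P T) → (∀ S → P S) ⊎ ∃[ S ] ¬ P S
∀-or-counterexample P P? P-resp with anySubset? (λ V → ¬? (P? (Vec.lookup V)))
... | yes (V , ¬PV) = inj₂ (Vec.lookup V , ¬PV)
... | no  ∄¬P      = inj₁ λ S → P-resp (Vecₚ.lookup∘tabulate S)
                                  (decidable-stable (P? _) (λ ¬PS → ∄¬P (Vec.tabulate S , ¬PS)))

record BinaryFlow (en : Ends n m) (act : Fin m → Bool) (d : Fin n → ℤ) : Set where
  field
    x        : Fin m → Bool
    x⊆act    : ∀ e → T (x e) → T (act e)
    boundary≡ : ∀ v → boundary en (λ e → [ x e ]) v ≡ d v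

zero-demand : (d : Fin n → ℤ) → sum d ≡ + 0 → (∀ S → d ⟨ S ⟩ ≤ + 0) → ∀ v → d v ≡ + 0
zero-demand d Σd≡0 d≤0 v = ℤₚ.≤-antisym d≤0′ 0≤d
  where
  open ℤₚ.≤-Reasoning
  singleton = λ u → does (v Finₚ.≟ u)
  d≤0′ : d v ≤ + 0
  d≤0′ = subst (_≤ + 0) (⟨⟩-singleton d v) (d≤0 singleton)
  0≤d : + 0 ≤ d v
  0≤d = begin
    + 0                                          ≡⟨ trans (⟨⟩-complement d singleton) Σd≡0 ⟨
    d ⟨ singleton ⟩ + d ⟨ not ∘ singleton ⟩
      ≤⟨ ℤₚ.+-monoʳ-≤ (d ⟨ singleton ⟩) (d≤0 (not ∘ singleton)) ⟩
    d ⟨ singleton ⟩ + + 0                        ≡⟨ ℤₚ.+-identityʳ _ ⟩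
    d ⟨ singleton ⟩                              ≡⟨ ⟨⟩-singleton d v ⟩
    d v                                          ∎

module _ (en : Ends n (suc m)) (act : Fin (suc m) → Bool) (d : Fin n → ℤ) where

  BinaryFlow-skip : BinaryFlow (en ∘ suc) (act ∘ suc) d → BinaryFlow en act d
  BinaryFlow-skip φ = record
    { x         = λ { zero → false ; (suc e) → x e }
    ; x⊆act     = λ { zero () ; (suc e) → x⊆act e }
    ; boundary≡ = λ v → trans (cong (_+_ (incidence (en zero) v * + 0)) (boundary≡ v))
                              (drop (incidence (en zero) v) (d v))
    }
    where
    open BinaryFlow φ
    drop : ∀ i y → i * + 0 + y ≡ y
    drop = solve-∀

  BinaryFlow-take : T (act zero) →
    BinaryFlow (en ∘ suc) (act ∘ suc) (λ v → d v - incidence (en zero) v) → BinaryFlow en act d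
  BinaryFlow-take act₀ φ = record
    { x         = λ { zero → true ; (suc e) → x e }
    ; x⊆act     = λ { zero _ → act₀ ; (suc e) → x⊆act e }
    ; boundary≡ = λ v → trans (cong (_+_ (incidence (en zero) v * + 1)) (boundary≡ v))
                              (restore (incidence (en zero) v) (d v))
    }
    where
    open BinaryFlow φ
    restore : ∀ i y → i * + 1 + (y - i) ≡ y
    restore = solve-∀

-- If the cut condition survives deleting the first edge a → b, the edge is
-- left unused; otherwise some S₁ is tight for it, and uncrossing with S₁ shows that the condition
-- survives deleting the edge and routing one unit of d along it.
hoffman : (en : Ends n m) (act : Fin m → Bool) (d : Fin n → ℤ) →
  sum d ≡ + 0 → (∀ S → d ⟨ S ⟩ ≤ cut en act S) → BinaryFlow en act d
hoffman {m = zero} en act d Σd≡0 d≤cut = record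
  { x = λ () ; x⊆act = λ () ; boundary≡ = λ v → sym (zero-demand d Σd≡0 d≤cut v) }
hoffman {n} {suc m} en act d Σd≡0 d≤cut = split (act zero) refl
  where
  en′ = en ∘ suc
  act′ = act ∘ suc
  cut′ = cut en′ act′
  a = proj₁ (en zero)
  b = proj₂ (en zero)

  first-edge : ∀ {t} S → act zero ≡ t → d ⟨ S ⟩ ≤ [ t ∧ S a ∧ not (S b) ] + cut′ S
  first-edge S refl = d≤cut S

  split : ∀ t → act zero ≡ t → BinaryFlow en act d
  split false act₀ = BinaryFlow-skip en act d (hoffman en′ act′ d Σd≡0 λ S →
                       subst (d ⟨ S ⟩ ≤_) (ℤₚ.+-identityˡ (cut′ S)) (first-edge S act₀))
  split true act₀ with ∀-or-counterexample (λ S → d ⟨ S ⟩ ≤ cut′ S) (λ S → d ⟨ S ⟩ ℤₚ.≤? cut′ S)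
                         (λ S≗T → subst₂ _≤_ (⟨⟩-congʳ d S≗T) (cut-cong en′ act′ S≗T))
  ... | inj₁ d≤cut′ = BinaryFlow-skip en act d (hoffman en′ act′ d Σd≡0 d≤cut′)
  ... | inj₂ (S₁ , S₁-violated) =
    BinaryFlow-take en act d (subst T (sym act₀) _) (hoffman en′ act′ d′ Σd′≡0 d′≤cut′)
    where
    d≤cut′+ab : ∀ S → d ⟨ S ⟩ ≤ [ S a ∧ not (S b) ] + cut′ S
    d≤cut′+ab S = first-edge S act₀
    open Uncrossing cut′ (cut-submodular en′ act′) d a b d≤cut′+ab S₁ S₁-violated
    d′ = λ v → d v - incidence (en zero) v
    d′≤cut′ : ∀ S → d′ ⟨ S ⟩ ≤ cut′ S
    d′≤cut′ S = subst (_≤ cut′ S) (sym (⟨⟩-shift d (en zero) S)) (uncross S)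
    Σd′≡0 : sum d′ ≡ + 0
    Σd′≡0 = begin
      sum d′                         ≡⟨ ⟨⟩-all d′ ⟨
      d′ ⟨ (λ _ → true) ⟩            ≡⟨ ⟨⟩-shift d (en zero) (λ _ → true) ⟩
      d ⟨ (λ _ → true) ⟩ - + 0       ≡⟨ ℤₚ.+-identityʳ _ ⟩
      d ⟨ (λ _ → true) ⟩             ≡⟨ ⟨⟩-all d ⟩
      sum d                          ≡⟨ Σd≡0 ⟩
      + 0                            ∎
      where open ≡-Reasoning

-- Orientations of G and of its multiples

signed : Bool → ℤ → ℤ
signed b x = if b then x else - x

ifEq-difference : (t h v : Fin n) (x : ℤ) → ifEq t v x - ifEq h v x ≡ incidence (t , h) v * x
ifEq-difference t h v x = begin
  ifEq t v x - ifEq h v x                          ≡⟨ cong₂ _-_ (ifEq-scale t v x) (ifEq-scale h v x) ⟩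
  ifEq t v (+ 1) * x - ifEq h v (+ 1) * x          ≡⟨ [y-z]x≈yx-zx x (ifEq t v (+ 1)) (ifEq h v (+ 1)) ⟨
  (ifEq t v (+ 1) - ifEq h v (+ 1)) * x            ∎
  where open ≡-Reasoning

incidence-signed : (b : Bool) (t h v : Fin n) (x : ℤ) →
  ifEq (if b then t else h) v x - ifEq (if b then h else t) v x ≡ incidence (t , h) v * signed b x
incidence-signed true  t h v x = ifEq-difference t h v x
incidence-signed false t h v x =
  trans (ifEq-difference h t v x) (reverse (ifEq t v (+ 1)) (ifEq h v (+ 1)) x)
  where
  reverse : ∀ a b x → (b - a) * x ≡ (a - b) * (- x)
  reverse = solve-∀

∂≡boundary : (G : Graph) (D : Orientation G) (f : Fin (nE G) → ℤ) (v : Fin (nV G)) →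
             ∂ G D f v ≡ boundary (ends G) (λ e → signed (D e) (f e)) v
∂≡boundary G D f v = begin
  ∂ G D f v                                        ≡⟨ cong₂ _-_ (sumFin≡sum (nE G) out) (sumFin≡sum (nE G) in′) ⟩
  sum out - sum in′                                ≡⟨ ∑-distrib-- out in′ ⟨
  ∑[ e < nE G ] (out e - in′ e)                    ≡⟨ sum-cong-≗ arc ⟩
  boundary (ends G) (λ e → signed (D e) (f e)) v   ∎
  where
  open ≡-Reasoning
  out in′ : Fin (nE G) → ℤ
  out e = ifEq (tail G D e) v (f e)
  in′ e = ifEq (head G D e) v (f e)
  arc : ∀ e → out e - in′ e ≡ incidence (ends G e) v * signed (D e) (f e)
  arc e = incidence-signed (D e) (proj₁ (ends G e)) (proj₂ (ends G e)) v (f e)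

positiveInDegree : (G : Graph) → Signature G → Fin (nV G) → ℤ
positiveInDegree G σ v = ∑[ e < nE G ] ifEq (proj₂ (ends G e)) v (posIndicator (σ e))

dplus≡boundary : (G : Graph) (σ : Signature G) (v : Fin (nV G)) →
  dplus G σ v ≡ boundary (ends G) (posIndicator ∘ σ) v + + 2 * positiveInDegree G σ v
dplus≡boundary G σ v = begin
  dplus G σ v                                         ≡⟨ sumFin≡sum (nE G) _ ⟩
  ∑[ e < nE G ] (ifEq (t e) v (π e) + ifEq (h e) v (π e))
    ≡⟨ sum-cong-≗ (λ e → split (ifEq (t e) v (π e)) (ifEq (h e) v (π e))) ⟩
  ∑[ e < nE G ] ((ifEq (t e) v (π e) - ifEq (h e) v (π e)) + + 2 * ifEq (h e) v (π e))
    ≡⟨ ∑-distrib-+ (λ e → ifEq (t e) v (π e) - ifEq (h e) v (π e)) (λ e → + 2 * ifEq (h e) v (π e)) ⟩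
  ∑[ e < nE G ] (ifEq (t e) v (π e) - ifEq (h e) v (π e)) + ∑[ e < nE G ] (+ 2 * ifEq (h e) v (π e))
    ≡⟨ cong₂ _+_ (sum-cong-≗ (λ e → ifEq-difference (t e) (h e) v (π e)))
                 (sym (*-distribˡ-sum (+ 2) (λ e → ifEq (h e) v (π e)))) ⟩
  boundary (ends G) π v + + 2 * positiveInDegree G σ v  ∎
  where
  open ≡-Reasoning
  π = posIndicator ∘ σ
  t h : Fin (nE G) → Fin (nV G)
  t e = proj₁ (ends G e)
  h e = proj₂ (ends G e)
  split : ∀ x y → x + y ≡ (x - y) + + 2 * y
  split = solve-∀

boundary-mult : ∀ k (en : Ends n m) (F : Fin (k ℕ.* m) → ℤ) (v : Fin n) →
  boundary (en ∘ remainder {k} m) F v ≡ boundary en (λ j → ∑[ i < k ] F (combine i j)) v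
boundary-mult {m = m} k en F v = begin
  ∑[ c < k ℕ.* m ] (incidence (en (remainder {k} m c)) v * F c)
    ≡⟨ ∑-combine {m} k (λ c → incidence (en (remainder {k} m c)) v * F c) ⟩
  ∑[ i < k ] ∑[ j < m ] (incidence (en (remainder {k} m (combine i j))) v * F (combine i j))
    ≡⟨ sum-cong-≗ {k} (λ i → sum-cong-≗ {m} (λ j → cong (λ r → incidence (en r) v * F (combine i j))
                                         (cong proj₂ (Finₚ.remQuot-combine i j)))) ⟩
  ∑[ i < k ] ∑[ j < m ] (incidence (en j) v * F (combine i j))
    ≡⟨ ∑-comm {k} {m} (λ i j → incidence (en j) v * F (combine i j)) ⟩
  ∑[ j < m ] ∑[ i < k ] (incidence (en j) v * F (combine i j))
    ≡⟨ sum-cong-≗ {m} (λ j → *-distribˡ-sum {k} (incidence (en j) v) (λ i → F (combine i j))) ⟨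
  boundary en (λ j → ∑[ i < k ] F (combine i j)) v  ∎
  where open ≡-Reasoning

forwardCopies : ∀ k (G : Graph) → Orientation (mult k G) → Fin (nE G) → ℤ
forwardCopies k G D j = ∑[ i < k ] [ D (combine i j) ]

∑-<ᵇ : ∀ k {t} → t ℕ.≤ k → ∑[ i < k ] [ toℕ i ℕ.<ᵇ t ] ≡ + t
∑-<ᵇ zero    z≤n       = refl
∑-<ᵇ (suc k) {zero}  _ = trans (ℤₚ.+-identityˡ _) (sum-replicate-zero k)
∑-<ᵇ (suc k) {suc t} (s≤s t≤k) = cong (_+_ (+ 1)) (∑-<ᵇ k t≤k)

forwardCopies-bounds : ∀ k (G : Graph) (D : Orientation (mult k G)) j →
                       forwardCopies k G D j ∈[ + 0 , + k ]
forwardCopies-bounds k G D j =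
  subst (_≤ forwardCopies k G D j) (sum-replicate-zero k) (∑-mono-≤ {k} (proj₁ ∘ bit ∘ copy)) ,
  subst (forwardCopies k G D j ≤_) (∑-one k) (∑-mono-≤ {k} (proj₂ ∘ bit ∘ copy))
  where
  copy : Fin k → Bool
  copy i = D (combine i j)
  bit : ∀ b → [ b ] ∈[ + 0 , + 1 ]
  bit true  = +≤+ z≤n , ℤₚ.≤-refl
  bit false = ℤₚ.≤-refl , +≤+ z≤n

outMinusIn-mult : ∀ k (G : Graph) (D : Orientation (mult k G)) (v : Fin (nV G)) →
  outMinusIn (mult k G) D v ≡ boundary (ends G) (λ j → + 2 * forwardCopies k G D j - + k) v
outMinusIn-mult k G D v = begin
  outMinusIn (mult k G) D v
    ≡⟨ ∂≡boundary (mult k G) D (λ _ → + 1) v ⟩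
  boundary (ends (mult k G)) (λ c → signed (D c) (+ 1)) v
    ≡⟨ boundary-mult k (ends G) (λ c → signed (D c) (+ 1)) v ⟩
  boundary (ends G) (λ j → ∑[ i < k ] signed (D (combine i j)) (+ 1)) v
    ≡⟨ boundary-cong (ends G) count v ⟩
  boundary (ends G) (λ j → + 2 * forwardCopies k G D j - + k) v  ∎
  where
  open ≡-Reasoning
  signed-one : ∀ b → signed b (+ 1) ≡ + 2 * [ b ] - + 1
  signed-one true  = refl
  signed-one false = refl
  count : ∀ j → ∑[ i < k ] signed (D (combine i j)) (+ 1) ≡ + 2 * forwardCopies k G D j - + k
  count j = begin
    ∑[ i < k ] signed (D (combine i j)) (+ 1)
      ≡⟨ sum-cong-≗ {k} (λ i → signed-one (D (combine i j))) ⟩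
    ∑[ i < k ] (+ 2 * [ D (combine i j) ] - + 1)
      ≡⟨ ∑-distrib-- {k} (λ i → + 2 * [ D (combine i j) ]) (λ _ → + 1) ⟩
    ∑[ i < k ] (+ 2 * [ D (combine i j) ]) - ∑[ i < k ] (+ 1)
      ≡⟨ cong₂ _-_ (sym (*-distribˡ-sum {k} (+ 2) (λ i → [ D (combine i j) ]))) (∑-one k) ⟩
    + 2 * forwardCopies k G D j - + k                 ∎

Admissible : (P Q : ℤ) → Sign → ℤ → Set
Admissible P Q pos x = x ∈[ Q , + 2 * P - Q ]
Admissible P Q neg x = x ∈[ + 0 , P - Q ] ⊎ x ∈[ P + Q , + 2 * P - + 1 ]

FlowValue≡Admissible : ∀ p q .{{_ : ℕ.NonZero p}} → q ℕ.≤ p → ∀ s x →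
  FlowValue (2 ℕ.* p) q s x ≡ Admissible (+ p) (+ q) s x
FlowValue≡Admissible p q q≤p pos x =
  cong (λ hi → + q ≤ x × x ≤ hi) (2p-minus q (ℕₚ.≤-trans q≤p (ℕₚ.m≤n*m p 2)))
  where
  2p-minus : ∀ k → k ℕ.≤ 2 ℕ.* p → + (2 ℕ.* p ℕ.∸ k) ≡ + 2 * + p - + k
  2p-minus k k≤2p = trans (pos-∸ k≤2p) (cong (_- + k) (ℤₚ.pos-* 2 p))
FlowValue≡Admissible p q q≤p neg x =
  cong₂ (λ hi₁ b₂ → x ∈[ + 0 , hi₁ ] ⊎ x ∈[ proj₁ b₂ , proj₂ b₂ ])
        (trans (cong (λ h → + (h ℕ.∸ q)) half) (pos-∸ q≤p))
        (cong₂ _,_ (trans (cong (λ h → + (h ℕ.+ q)) half) (ℤₚ.pos-+ p q))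
                   (trans (pos-∸ 1≤2p) (cong (_- + 1) (ℤₚ.pos-* 2 p))))
  where
  1≤2p : 1 ℕ.≤ 2 ℕ.* p
  1≤2p = ℕₚ.≤-trans (ℕ.>-nonZero⁻¹ p) (ℕₚ.m≤n*m p 2)
  half : (2 ℕ.* p) / 2 ≡ p
  half = trans (cong (_/ 2) (ℕₚ.*-comm 2 p)) (m*n/n≡m p 2)

module EdgeValues (P Q : ℤ) (0≤Q : + 0 ≤ Q) (Q≤P : Q ≤ P) where

  Centred : ℤ → Set
  Centred g = g ∈[ - (P - Q) , P - Q ]

  record Residue (s : Sign) (y : ℤ) : Set where
    field
      g w     : ℤ
      centred : Centred g
      y≡      : y ≡ g + P * posIndicator s + + 2 * P * w

  private
    0≤P-Q : + 0 ≤ P - Q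
    0≤P-Q = ℤₚ.i≤j⇒0≤j-i Q≤P

    -[P-Q]≤0 : - (P - Q) ≤ + 0
    -[P-Q]≤0 = ℤₚ.neg-mono-≤ 0≤P-Q

    -1≤P-Q : - + 1 ≤ P - Q
    -1≤P-Q = ℤₚ.≤-trans ℤ.-≤+ 0≤P-Q

    0≤P : + 0 ≤ P
    0≤P = ℤₚ.≤-trans 0≤Q Q≤P

    0≤P+Q : + 0 ≤ P + Q
    0≤P+Q = ℤₚ.+-mono-≤ 0≤P 0≤Q

    P-Q≤2P : P - Q ≤ + 2 * P
    P-Q≤2P = subst (P - Q ≤_) P-Q+[P+Q]≡2P (i≤i+j (P - Q) 0≤P+Q)
      where
      P-Q+[P+Q]≡2P : P - Q + (P + Q) ≡ + 2 * P
      P-Q+[P+Q]≡2P = solve (P ∷ Q ∷ [])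

  admissible⇒residue : ∀ s {x} → Admissible P Q s x → Residue s x
  admissible⇒residue pos {x} x∈ = record
    { g = x - P ; w = + 0
    ; centred = ∈-cast (∈-shift (- P) x∈) (- (P - Q)) (P - Q)
                       (solve (P ∷ Q ∷ [])) (solve (P ∷ Q ∷ []))
    ; y≡ = solve (x ∷ P ∷ []) }
  admissible⇒residue neg {x} (inj₁ x∈) = record
    { g = x ; w = + 0
    ; centred = ∈-weaken -[P-Q]≤0 ℤₚ.≤-refl x∈
    ; y≡ = solve (x ∷ P ∷ []) }
  admissible⇒residue neg {x} (inj₂ x∈) = record
    { g = x - + 2 * P ; w = + 1
    ; centred = ∈-weaken ℤₚ.≤-refl -1≤P-Q
                  (∈-cast (∈-shift (- (+ 2 * P)) x∈) (- (P - Q)) (- + 1)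
                          (solve (P ∷ Q ∷ [])) (solve (P ∷ [])))
    ; y≡ = solve (x ∷ P ∷ []) }

  residue-neg : ∀ {s y} → Residue s y → Residue s (- y)
  residue-neg {s} {y} ρ = record
    { g = - g ; w = - w - posIndicator s
    ; centred = ∈-cast (∈-negate centred) (- (P - Q)) (P - Q) refl (ℤₚ.neg-involutive (P - Q))
    ; y≡ = trans (cong -_ y≡) (negate g P (posIndicator s) w) }
    where
    open Residue ρ
    negate : ∀ g P π w → - (g + P * π + + 2 * P * w) ≡ - g + P * π + + 2 * P * (- w - π)
    negate = solve-∀

  signed-residue : ∀ {s y} b → Residue s y → Residue s (signed b y)
  signed-residue true  ρ = ρ
  signed-residue false ρ = residue-neg ρ

  record Lift (s : Sign) (g : ℤ) : Set where
    field
      r c        : ℤ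
      admissible : Admissible P Q s r
      r≡         : r ≡ g + P * posIndicator s + + 2 * P * c

  centred⇒lift : ∀ s {g} → Centred g → Lift s g
  centred⇒lift pos {g} g∈ = record
    { r = g + P ; c = + 0
    ; admissible = ∈-cast (∈-shift P g∈) Q (+ 2 * P - Q) (solve (P ∷ Q ∷ [])) (solve (P ∷ Q ∷ []))
    ; r≡ = solve (g ∷ P ∷ []) }
  centred⇒lift neg {g} g∈ = split (+ 0 ℤₚ.≤? g)
    where
    split : Dec (+ 0 ≤ g) → Lift neg g
    split (yes 0≤g) = record
      { r = g ; c = + 0
      ; admissible = inj₁ (0≤g , proj₂ g∈)
      ; r≡ = solve (g ∷ P ∷ []) }
    split (no 0≰g) = record
      { r = g + + 2 * P ; c = + 1
      ; admissible = inj₂ (∈-cast (∈-shift (+ 2 * P) (proj₁ g∈ , i<0⇒i≤-1 (ℤₚ.≰⇒> 0≰g)))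
                                  (P + Q) (+ 2 * P - + 1) (solve (P ∷ Q ∷ [])) (solve (P ∷ [])))
      ; r≡ = solve (g ∷ P ∷ []) }

  admissible-bounded : ∀ s {r} → Admissible P Q s r → r ∈[ + 0 , + 2 * P ]
  admissible-bounded pos        r∈ = ∈-weaken 0≤Q (i-j≤i (+ 2 * P) 0≤Q) r∈
  admissible-bounded neg (inj₁ r∈) = ∈-weaken ℤₚ.≤-refl P-Q≤2P r∈
  admissible-bounded neg (inj₂ r∈) = ∈-weaken 0≤P+Q (i-j≤i (+ 2 * P) (+≤+ z≤n)) r∈

  admissible-flip : ∀ s {r} → Admissible P Q s r → r ≢ + 0 → Admissible P Q s (+ 2 * P - r)
  admissible-flip pos r∈ _ =
    ∈-cast (∈-reflect (+ 2 * P) r∈) Q (+ 2 * P - Q) (solve (P ∷ Q ∷ [])) refl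
  admissible-flip neg (inj₁ r∈) r≢0 =
    inj₂ (∈-cast (∈-reflect (+ 2 * P) (0≤i⇒i≢0⇒1≤i (proj₁ r∈) r≢0 , proj₂ r∈))
                 (P + Q) (+ 2 * P - + 1) (solve (P ∷ Q ∷ [])) refl)
  admissible-flip neg (inj₂ r∈) _ =
    inj₁ (∈-weaken (+≤+ z≤n) ℤₚ.≤-refl
                   (∈-cast (∈-reflect (+ 2 * P) r∈) (+ 1) (P - Q)
                           (solve (P ∷ [])) (solve (P ∷ Q ∷ []))))

  reorient : ∀ s {r} → Admissible P Q s r → (x : Bool) → (T x → r ≢ + 0) →
    Admissible P Q s (if x then + 2 * P - r else r) ×
    signed (not x) (if x then + 2 * P - r else r) ≡ r + (- (+ 2 * P)) * [ x ]
  reorient s {r} r∈ true  r≢0 = admissible-flip s r∈ (r≢0 _) , reversed r P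
    where
    reversed : ∀ r P → - (+ 2 * P - r) ≡ r + (- (+ 2 * P)) * + 1
    reversed = solve-∀
  reorient s {r} r∈ false _   = r∈ , kept r P
    where
    kept : ∀ r P → r ≡ r + (- (+ 2 * P)) * + 0
    kept = solve-∀

nonzero : ℤ → Bool
nonzero r = not (does (r ℤ.≟ + 0))

nonzero⇒≢0 : ∀ r → T (nonzero r) → r ≢ + 0
nonzero⇒≢0 (+ suc _) _ ()

leaving-bound : ∀ {M r} α β → r ∈[ + 0 , M ] →
                ([ α ] - [ β ]) * r ≤ M * [ nonzero r ∧ α ∧ not β ]
leaving-bound {M} {+ zero} α β _ =
  ℤₚ.≤-reflexive (trans (ℤₚ.*-zeroʳ ([ α ] - [ β ])) (sym (ℤₚ.*-zeroʳ M)))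
leaving-bound {M} {r@(+ suc _)} α β (0≤r , r≤M) = bound α β
  where
  bound : ∀ α β → ([ α ] - [ β ]) * r ≤ M * [ α ∧ not β ]
  bound true  true  = ℤₚ.≤-reflexive (sym (ℤₚ.*-zeroʳ M))
  bound true  false = subst₂ _≤_ (sym (ℤₚ.*-identityˡ r)) (sym (ℤₚ.*-identityʳ M)) r≤M
  bound false true  = subst₂ _≤_ (sym (ℤₚ.-1*i≡-i r)) (sym (ℤₚ.*-zeroʳ M)) (ℤₚ.neg-mono-≤ 0≤r)
  bound false false = ℤₚ.≤-reflexive (sym (ℤₚ.*-zeroʳ M))

-- The reduction

module Reduction (p q : ℕ) .{{_ : ℕ.NonZero p}} (q≤p : q ℕ.≤ p) (G : Graph) (σ : Signature G) where

  P Q : ℤ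
  P = + p
  Q = + q

  K : ℕ
  K = 2 ℕ.* p ℕ.∸ 2 ℕ.* q

  β : Fin (nV G) → ℤ
  β v = + (2 ℕ.* p) * dplus G σ v

  open EdgeValues P Q (+≤+ z≤n) (+≤+ q≤p)

  B : (Fin (nE G) → ℤ) → Fin (nV G) → ℤ
  B = boundary (ends G)

  π : Fin (nE G) → ℤ
  π = posIndicator ∘ σ

  indeg⁺ : Fin (nV G) → ℤ
  indeg⁺ = positiveInDegree G σ

  +K≡ : + K ≡ + 2 * (P - Q)
  +K≡ = trans (pos-∸ (ℕₚ.*-monoʳ-≤ 2 q≤p))
              (trans (cong₂ _-_ (ℤₚ.pos-* 2 p) (ℤₚ.pos-* 2 q)) (sym (x[y-z]≈xy-xz (+ 2) P Q)))

  β≡ : ∀ v → β v ≡ + 2 * P * (B π v + + 2 * indeg⁺ v)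
  β≡ v = cong₂ _*_ (ℤₚ.pos-* 2 p) (dplus≡boundary G σ v)

  toAdmissible : ∀ s {x} → FlowValue (2 ℕ.* p) q s x → Admissible P Q s x
  toAdmissible s {x} = subst id (FlowValue≡Admissible p q q≤p s x)

  fromAdmissible : ∀ s {x} → Admissible P Q s x → FlowValue (2 ℕ.* p) q s x
  fromAdmissible s {x} = subst id (sym (FlowValue≡Admissible p q q≤p s x))

  module Forward (φ : PQFlow (2 ℕ.* p) q G σ) where
    open PQFlow φ

    y : Fin (nE G) → ℤ
    y e = signed (D e) (f e)

    ρ : ∀ e → Residue (σ e) (y e)
    ρ e = signed-residue (D e) (admissible⇒residue (σ e) (toAdmissible (σ e) (values e)))

    g w : Fin (nE G) → ℤ
    g e = Residue.g (ρ e)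
    w e = Residue.w (ρ e)

    t∈ : ∀ e → g e + (P - Q) ∈[ + 0 , + K ]
    t∈ e = ∈-cast (∈-shift (P - Q) (Residue.centred (ρ e))) (+ 0) (+ K)
                  (ℤₚ.+-inverseˡ (P - Q)) (trans (double (P - Q)) (sym +K≡))
      where
      double : ∀ x → x + x ≡ + 2 * x
      double = solve-∀

    t : Fin (nE G) → ℕ
    t e = ℤ.∣ g e + (P - Q) ∣

    +t≡ : ∀ e → + t e ≡ g e + (P - Q)
    +t≡ e = ℤₚ.0≤i⇒+∣i∣≡i (proj₁ (t∈ e))

    t≤K : ∀ e → t e ℕ.≤ K
    t≤K e = ℤₚ.drop‿+≤+ (subst (_≤ + K) (sym (+t≡ e)) (proj₂ (t∈ e)))

    D′ : Orientation (mult K G)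
    D′ c = toℕ (quotient {K} (nE G) c) ℕ.<ᵇ t (remainder {K} (nE G) c)

    copies : ∀ j → forwardCopies K G D′ j ≡ + t j
    copies j = trans (sum-cong-≗ {K} (λ i → cong₂ (λ a b → [ toℕ a ℕ.<ᵇ t b ])
                                           (cong proj₁ (Finₚ.remQuot-combine i j))
                                           (cong proj₂ (Finₚ.remQuot-combine i j))))
                     (∑-<ᵇ K (t≤K j))

    copies-residue : ∀ j →
      + 2 * forwardCopies K G D′ j - + K ≡ + 2 * y j + (- (+ 2 * P)) * π j + (- (+ 4 * P)) * w j
    copies-residue j = begin
      + 2 * forwardCopies K G D′ j - + K
        ≡⟨ cong₂ (λ c k → + 2 * c - k) (trans (copies j) (+t≡ j)) +K≡ ⟩
      + 2 * (g j + (P - Q)) - + 2 * (P - Q)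
        ≡⟨ expand P Q (g j) (π j) (w j) ⟩
      + 2 * (g j + P * π j + + 2 * P * w j) + (- (+ 2 * P)) * π j + (- (+ 4 * P)) * w j
        ≡⟨ cong (λ z → + 2 * z + (- (+ 2 * P)) * π j + (- (+ 4 * P)) * w j) (Residue.y≡ (ρ j)) ⟨
      + 2 * y j + (- (+ 2 * P)) * π j + (- (+ 4 * P)) * w j  ∎
      where
      open ≡-Reasoning
      expand : ∀ P Q g π w → + 2 * (g + (P - Q)) - + 2 * (P - Q)
                              ≡ + 2 * (g + P * π + + 2 * P * w) + (- (+ 2 * P)) * π + (- (+ 4 * P)) * w
      expand = solve-∀

    quotient′ : Fin (nV G) → ℤ
    quotient′ v = - (B π v + B w v + indeg⁺ v)

    outMinusIn-β : ∀ v → outMinusIn (mult K G) D′ v - β v ≡ quotient′ v * + (4 ℕ.* p)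
    outMinusIn-β v = begin
      outMinusIn (mult K G) D′ v - β v
        ≡⟨ cong₂ _-_ (trans (outMinusIn-mult K G D′ v)
                            (boundary-linear (ends G) (+ 2) (- (+ 2 * P)) (- (+ 4 * P)) y π w _ copies-residue v))
                     (β≡ v) ⟩
      + 2 * B y v + (- (+ 2 * P)) * B π v + (- (+ 4 * P)) * B w v - + 2 * P * (B π v + + 2 * indeg⁺ v)
        ≡⟨ collect P (B y v) (B π v) (B w v) (indeg⁺ v) (trans (sym (∂≡boundary G D f v)) (conserv v)) ⟩
      quotient′ v * (+ 4 * P)
        ≡⟨ cong (quotient′ v *_) (ℤₚ.pos-* 4 p) ⟨
      quotient′ v * + (4 ℕ.* p)  ∎
      where
      open ≡-Reasoning
      collect : ∀ P y b c a → y ≡ + 0 →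
        + 2 * y + (- (+ 2 * P)) * b + (- (+ 4 * P)) * c - + 2 * P * (b + + 2 * a) ≡ (- (b + c + a)) * (+ 4 * P)
      collect P y b c a refl = solve (P ∷ b ∷ c ∷ a ∷ [])

    orientation : ZmOrientation (4 ℕ.* p) (mult K G) β
    orientation = record
      { D     = D′
      ; bound = λ v → Signed.∣⇒∣ᵤ (Signed.divides (quotient′ v) (outMinusIn-β v)) }

  private instance
    2P-positive : ℤ.Positive (+ 2 * P)
    2P-positive =
      ℤ.positive (subst (+ 0 <_) (ℤₚ.pos-* 2 p) (ℤ.+<+ (ℕ.>-nonZero⁻¹ (2 ℕ.* p) {{ℕₚ.m*n≢0 2 p}})))

    2P-nonZero : ℤ.NonZero (+ 2 * P)
    2P-nonZero = ℤ.>-nonZero (ℤₚ.positive⁻¹ (+ 2 * P))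

  module Backward (ω : ZmOrientation (4 ℕ.* p) (mult K G) β) where
    open ZmOrientation ω renaming (D to D′)

    g : Fin (nE G) → ℤ
    g j = forwardCopies K G D′ j - (P - Q)

    g-centred : ∀ j → Centred (g j)
    g-centred j = ∈-cast (∈-shift (- (P - Q)) (forwardCopies-bounds K G D′ j)) (- (P - Q)) (P - Q)
                         (ℤₚ.+-identityˡ _) (trans (cong (_- (P - Q)) +K≡) (halve (P - Q)))
      where
      halve : ∀ x → + 2 * x - x ≡ x
      halve = solve-∀

    lift : ∀ j → Lift (σ j) (g j)
    lift j = centred⇒lift (σ j) (g-centred j)

    r c : Fin (nE G) → ℤ
    r j = Lift.r (lift j)
    c j = Lift.c (lift j)

    divides : ∀ v → + (4 ℕ.* p) Signed.∣ (outMinusIn (mult K G) D′ v - β v)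
    divides v = Signed.∣ᵤ⇒∣ (bound v)

    z : Fin (nV G) → ℤ
    z v = Signed.quotient (divides v)

    outMinusIn≡ : ∀ v → outMinusIn (mult K G) D′ v ≡ z v * + (4 ℕ.* p) + β v
    outMinusIn≡ v = trans (split (outMinusIn (mult K G) D′ v) (β v))
                          (cong (_+ β v) (Signed._∣_.equality (divides v)))
      where
      split : ∀ a b → a ≡ (a - b) + b
      split = solve-∀

    Bg≡ : ∀ v → B g v ≡ P * B π v + + 2 * P * indeg⁺ v + + 2 * P * z v
    Bg≡ v = ℤₚ.*-cancelˡ-≡ (+ 2) _ _ (begin
      + 2 * B g v                                      ≡⟨ boundary-* (ends G) (+ 2) g v ⟨
      B (λ j → + 2 * g j) v                            ≡⟨ boundary-cong (ends G) twice-g v ⟩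
      B (λ j → + 2 * forwardCopies K G D′ j - + K) v   ≡⟨ outMinusIn-mult K G D′ v ⟨
      outMinusIn (mult K G) D′ v                       ≡⟨ outMinusIn≡ v ⟩
      z v * + (4 ℕ.* p) + β v                          ≡⟨ cong₂ (λ k b → z v * k + b) (ℤₚ.pos-* 4 p) (β≡ v) ⟩
      z v * (+ 4 * P) + + 2 * P * (B π v + + 2 * indeg⁺ v)
                                                       ≡⟨ collect P (B π v) (indeg⁺ v) (z v) ⟩
      + 2 * (P * B π v + + 2 * P * indeg⁺ v + + 2 * P * z v) ∎)
      where
      open ≡-Reasoning
      twice-g : ∀ j → + 2 * g j ≡ + 2 * forwardCopies K G D′ j - + K
      twice-g j = trans (x[y-z]≈xy-xz (+ 2) (forwardCopies K G D′ j) (P - Q))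
                        (cong (_-_ (+ 2 * forwardCopies K G D′ j)) (sym +K≡))
      collect : ∀ P b a z →
        z * (+ 4 * P) + + 2 * P * (b + + 2 * a) ≡ + 2 * (P * b + + 2 * P * a + + 2 * P * z)
      collect = solve-∀

    demand : Fin (nV G) → ℤ
    demand v = B π v + indeg⁺ v + z v + B c v

    Br≡ : ∀ v → B r v ≡ + 2 * P * demand v
    Br≡ v = begin
      B r v
        ≡⟨ boundary-linear (ends G) (+ 1) P (+ 2 * P) g π c r r≡ v ⟩
      + 1 * B g v + P * B π v + + 2 * P * B c v
        ≡⟨ cong (λ x → + 1 * x + P * B π v + + 2 * P * B c v) (Bg≡ v) ⟩
      + 1 * (P * B π v + + 2 * P * indeg⁺ v + + 2 * P * z v) + P * B π v + + 2 * P * B c v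
        ≡⟨ collect P (B π v) (indeg⁺ v) (z v) (B c v) ⟩
      + 2 * P * demand v  ∎
      where
      open ≡-Reasoning
      r≡ : ∀ j → r j ≡ + 1 * g j + P * π j + + 2 * P * c j
      r≡ j = trans (Lift.r≡ (lift j))
                   (cong (λ x → x + P * π j + + 2 * P * c j) (sym (ℤₚ.*-identityˡ (g j))))
      collect : ∀ P b a z k → + 1 * (P * b + + 2 * P * a + + 2 * P * z) + P * b + + 2 * P * k
                                ≡ + 2 * P * (b + a + z + k)
      collect = solve-∀

    Σdemand≡0 : sum demand ≡ + 0
    Σdemand≡0 = ℤₚ.*-cancelˡ-≡ (+ 2 * P) _ _ (begin
      + 2 * P * sum demand                  ≡⟨ *-distribˡ-sum (+ 2 * P) demand ⟩
      ∑[ v < nV G ] (+ 2 * P * demand v)    ≡⟨ sum-cong-≗ Br≡ ⟨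
      sum (B r)                             ≡⟨ ∑-boundary (ends G) r ⟩
      + 0                                   ≡⟨ ℤₚ.*-zeroʳ (+ 2 * P) ⟨
      + 2 * P * + 0                         ∎)
      where open ≡-Reasoning

    act : Fin (nE G) → Bool
    act e = nonzero (r e)

    demand≤cut : ∀ S → demand ⟨ S ⟩ ≤ cut (ends G) act S
    demand≤cut S = ℤₚ.*-cancelˡ-≤-pos _ _ (+ 2 * P) (begin
      + 2 * P * demand ⟨ S ⟩                 ≡⟨ ⟨⟩-* (+ 2 * P) demand S ⟩
      (λ v → + 2 * P * demand v) ⟨ S ⟩       ≡⟨ ⟨⟩-congˡ S Br≡ ⟨
      B r ⟨ S ⟩                              ≡⟨ boundary⟨⟩ (ends G) r S ⟩
      ∑[ e < nE G ] (([ S (t e) ] - [ S (h e) ]) * r e)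
        ≤⟨ ∑-mono-≤ (λ e → leaving-bound (S (t e)) (S (h e)) (r-bounded e)) ⟩
      ∑[ e < nE G ] (+ 2 * P * leaving e)
        ≡⟨ *-distribˡ-sum (+ 2 * P) leaving ⟨
      + 2 * P * cut (ends G) act S           ∎)
      where
      open ℤₚ.≤-Reasoning
      t h : Fin (nE G) → Fin (nV G)
      t e = proj₁ (ends G e)
      h e = proj₂ (ends G e)
      r-bounded : ∀ e → r e ∈[ + 0 , + 2 * P ]
      r-bounded e = admissible-bounded (σ e) (Lift.admissible (lift e))
      leaving : Fin (nE G) → ℤ
      leaving e = [ act e ∧ S (t e) ∧ not (S (h e)) ]

    open BinaryFlow (hoffman (ends G) act demand Σdemand≡0 demand≤cut)

    D″ : Orientation G
    D″ e = not (x e)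

    f″ : Fin (nE G) → ℤ
    f″ e = if x e then + 2 * P - r e else r e

    reoriented : ∀ e →
      Admissible P Q (σ e) (f″ e) × signed (D″ e) (f″ e) ≡ r e + (- (+ 2 * P)) * [ x e ]
    reoriented e = reorient (σ e) (Lift.admissible (lift e)) (x e) (nonzero⇒≢0 (r e) ∘ x⊆act e)

    conserved : ∀ v → ∂ G D″ f″ v ≡ + 0
    conserved v = begin
      ∂ G D″ f″ v
        ≡⟨ ∂≡boundary G D″ f″ v ⟩
      B (λ e → signed (D″ e) (f″ e)) v
        ≡⟨ boundary-cong (ends G) (proj₂ ∘ reoriented) v ⟩
      B (λ e → r e + (- (+ 2 * P)) * [ x e ]) v
        ≡⟨ boundary-+ (ends G) r (λ e → (- (+ 2 * P)) * [ x e ]) v ⟩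
      B r v + B (λ e → (- (+ 2 * P)) * [ x e ]) v
        ≡⟨ cong₂ _+_ (Br≡ v) (boundary-* (ends G) (- (+ 2 * P)) (λ e → [ x e ]) v) ⟩
      + 2 * P * demand v + (- (+ 2 * P)) * B (λ e → [ x e ]) v
        ≡⟨ cong (λ y → + 2 * P * demand v + (- (+ 2 * P)) * y) (boundary≡ v) ⟩
      + 2 * P * demand v + (- (+ 2 * P)) * demand v
        ≡⟨ cancel (+ 2 * P) (demand v) ⟩
      + 0  ∎
      where
      open ≡-Reasoning
      cancel : ∀ a b → a * b + (- a) * b ≡ + 0
      cancel = solve-∀

    flow : PQFlow (2 ℕ.* p) q G σ
    flow = record
      { D       = D″
      ; f       = f″
      ; values  = λ e → fromAdmissible (σ e) (proj₁ (reoriented e))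
      ; conserv = conserved }

theorem5p13 : (p q : ℕ) → .{{_ : ℕ.NonZero q}} → q ℕ.≤ p →
    (G : Graph) (σ : Signature G) →
    PQFlow (2 ℕ.* p) q G σ
      ⇔ ZmOrientation (4 ℕ.* p) (mult (2 ℕ.* p ℕ.∸ 2 ℕ.* q) G)
          (λ v → (+ (2 ℕ.* p)) ℤ.* dplus G σ v)
theorem5p13 p q q≤p G σ = mk⇔ Forward.orientation Backward.flow
  where
  instance
    p-nonZero : ℕ.NonZero p
    p-nonZero = ℕ.>-nonZero (ℕₚ.<-≤-trans (ℕ.>-nonZero⁻¹ q) q≤p)
  open Reduction p q q≤p G σ
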